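{- If $G$ is a connected $K_t$-minor-free graph of diameter $d$ and order $n$, with a resolving set of size $k$, then $n\leq (dk+1)^{t-1}+1$.
   Context: Graphs are finite and simple. A resolving set of $G$ is a set $R$ of vertices such that for every pair $u\neq v$ there is $x\in R$ with $d(x,u)\neq d(x,v)$. $G$ is $K_t$-minor-free if the complete graph $K_t$ cannot be obtained from $G$ by vertex deletions, edge deletions and edge contractions. -}

module Defs where

open import Data.Nat using (ℕ; zero; suc; _≤_)
open import Data.Fin using (Fin)
open import Data.Unit using (⊤)
open import Data.Maybe using (Maybe; just)
open import Data.Product using (Σ; ∃; _×_; _,_)
open import Data.Fin.Subset using (Subset; _∈_; ∣_∣)
open import Relation.Nullary using (¬_)
open import Relation.Binary.PropositionalEquality using (_≡_; _≢_)

record Graph (n : ℕ) : Set₁ where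
  field
    Adj   : Fin n → Fin n → Set
    sym   : ∀ {u v} → Adj u v → Adj v u
    irrefl : ∀ {u} → ¬ Adj u u
open Graph public

data Walk {n : ℕ} (G : Graph n) (P : Fin n → Set) : Fin n → Fin n → ℕ → Set where
  here : ∀ {u} → P u → Walk G P u u zero
  step : ∀ {u w v ℓ} → P u → Adj G u w → Walk G P w v ℓ → Walk G P u v (suc ℓ)

Everywhere : {n : ℕ} → Fin n → Set
Everywhere _ = ⊤

Dist : {n : ℕ} → Graph n → Fin n → Fin n → ℕ → Set
Dist G u v ℓ = Walk G Everywhere u v ℓ × (∀ m → Walk G Everywhere u v m → ℓ ≤ m)

Connected : {n : ℕ} → Graph n → Set
Connected G = ∀ u v → ∃ λ ℓ → Walk G Everywhere u v ℓ

HasDiameter : {n : ℕ} → Graph n → ℕ → Set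
HasDiameter G d =
  (∀ u v ℓ → Dist G u v ℓ → ℓ ≤ d) × (∃ λ u → ∃ λ v → Dist G u v d)

Resolving : {n : ℕ} → Graph n → Subset n → Set
Resolving G R = ∀ u v → u ≢ v →
  ∃ λ x → x ∈ R × (∀ a b → Dist G x u a → Dist G x v b → a ≢ b)

-- K_t minor model (branch sets): f assigns to some vertices a branch index
-- in Fin t (disjointness is automatic); every branch set is nonempty and
-- induces a connected subgraph, and any two distinct branch sets are joined
-- by an edge.
InBranch : {n t : ℕ} → (Fin n → Maybe (Fin t)) → Fin t → Fin n → Set
InBranch f i v = f v ≡ just i

HasCompleteMinor : {n : ℕ} → Graph n → ℕ → Set
HasCompleteMinor {n} G t = Σ (Fin n → Maybe (Fin t)) λ f →
    (∀ i → ∃ λ v → InBranch f i v)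
  × (∀ i u v → InBranch f i u → InBranch f i v → ∃ λ ℓ → Walk G (InBranch f i) u v ℓ)
  × (∀ i j → i ≢ j → ∃ λ u → ∃ λ v → InBranch f i u × InBranch f j v × Adj G u v)

MinorFree : {n : ℕ} → Graph n → ℕ → Set
MinorFree G t = ¬ HasCompleteMinor G t

{-# OPTIONS --safe #-}
module Submission where

-- Encode a vertex w by the set of balls B(x, r), x ∈ R, r < d, containing it: there are d·k such
-- balls, and the encoding is injective because R resolves G and all distances are at most d.
-- Suppose the codes shattered t ≥ 3 balls. Then for every pair i ≠ j some vertex lies in the balls
-- i and j and in no other, and the additively weighted Voronoi cells of the centres (weight:
-- distance minus radius) are connected, contain their own centres and are pairwise adjacent: they
-- are the branch sets of a K_t minor. Hence Sauer–Shelah bounds the number of codes by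
-- Σ_{i<t} C(dk, i) ≤ (dk + 1)^(t - 1). For t ≤ 2, t vertices of a connected graph already carry a
-- K_t minor.

open import Defs
open import Data.Nat
  using (ℕ; zero; suc; _≤_; _<_; _+_; _*_; _^_; _∸_; _≤?_; _<?_; z≤n; s≤s; s≤s⁻¹)
open import Data.Nat.Properties
  using ( module ≤-Reasoning; ≤-refl; ≤-reflexive; ≤-trans; ≤-antisym
        ; <⇒≤; ≮⇒≥; <⇒≱; ≰⇒>; ≤∧≢⇒<
        ; n≤0⇒n≡0; n≤1+n; m≤m+n; m≤n+m; m+[n∸m]≡n
        ; +-comm; +-assoc; +-suc; +-identityʳ; +-commutativeSemigroup
        ; +-mono-≤; +-monoˡ-≤; +-monoʳ-≤; +-monoˡ-<; +-cancelʳ-≤; +-cancelˡ-<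
        ; *-monoˡ-≤; *-monoʳ-≤; ^-zeroˡ; ^-monoˡ-≤ )
open import Data.Nat.DivMod using (_%_; [m+kn]%n≡m%n; m<n⇒m%n≡m)
open import Algebra.Properties.CommutativeSemigroup +-commutativeSemigroup
  using (x∙yz≈y∙xz; interchange)
open import Data.Bool using (Bool; true; false; T; if_then_else_; _∨_; _∧_)
open import Data.Bool.Properties using (T-∧; T-∨)
import Data.Bool as Bool
open import Data.Fin using (Fin; zero; suc; toℕ; fromℕ<; remQuot; combine)
open import Data.Fin.Properties
  using (_≟_; any?; sequence; suc-injective; toℕ<n; toℕ-injective; toℕ-fromℕ<; remQuot-combine)
open import Data.Fin.Subset using (Subset; ∣_∣; _∈_)
open import Data.List using (allFin)
open import Data.List.Extrema.Nat using (argmin; f[argmin]≤f[xs])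
import Data.List.Relation.Unary.All as All
open import Data.List.Membership.Propositional.Properties using (∈-allFin)
open import Data.Maybe using (Maybe; just; nothing)
open import Data.Maybe.Properties using (just-injective)
open import Data.Product using (∃; ∃₂; _×_; _,_; proj₁; proj₂)
import Data.Product as Product
open import Data.Sum using (_⊎_; inj₁; inj₂; [_,_])
import Data.Sum as Sum
open import Data.Unit using (tt)
open import Data.Vec using ([]; _∷_; lookup; tabulate; here; there)
open import Data.Vec.Properties using (≡-dec; lookup∘tabulate)
open import Effect.Monad using (RawMonad)
open import Function using (_∘_; _⇔_; mk⇔; Equivalence)
open import Function.Definitions using (Injective)
open import Relation.Binary.Definitions using (DecidableEquality)
open import Relation.Binary.PropositionalEquality
  using (_≡_; _≢_; refl; trans; cong; cong₂; subst; subst₂)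
import Relation.Binary.PropositionalEquality as ≡
open import Relation.Nullary using (¬_; Dec; yes; no; does; contradiction)
open import Relation.Nullary.Decidable
  using (map′; _×-dec_; _⊎-dec_; ¬¬-excluded-middle; decidable-stable)
open import Relation.Nullary.Negation using (¬¬-Monad; ¬¬-map)

module _ {n : ℕ} {G : Graph n} {P : Fin n → Set} where

  walk-head : ∀ {u v ℓ} → Walk G P u v ℓ → P u
  walk-head (here p)     = p
  walk-head (step p _ _) = p

  infixr 5 _++ʷ_
  _++ʷ_ : ∀ {u v w a b} → Walk G P u v a → Walk G P v w b → Walk G P u w (a + b)
  here _     ++ʷ q = q
  step p e r ++ʷ q = step p e (r ++ʷ q)

  walk-snoc : ∀ {u v w ℓ} → Walk G P u v ℓ → Adj G v w → P w → Walk G P u w (suc ℓ)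
  walk-snoc (here p)     e q = step p e (here q)
  walk-snoc (step p e r) f q = step p e (walk-snoc r f q)

  walk-reverse : ∀ {u v ℓ} → Walk G P u v ℓ → Walk G P v u ℓ
  walk-reverse (here p)     = here p
  walk-reverse (step p e r) = walk-snoc (walk-reverse r) (Graph.sym G e) p

  walk-crossing : ∀ {A : Set} (c : Fin n → A) {i j : A} →
                  (∀ {z} → P z → c z ≡ i ⊎ c z ≡ j) → i ≢ j →
                  ∀ {u y ℓ} → c u ≡ i → c y ≡ j → Walk G P u y ℓ →
                  ∃₂ λ p q → c p ≡ i × c q ≡ j × Adj G p q
  walk-crossing c two i≢j cu≡i cy≡j (here _)     = contradiction (trans (≡.sym cu≡i) cy≡j) i≢j
  walk-crossing c two i≢j cu≡i cy≡j (step _ e r) with two (walk-head r)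
  ... | inj₁ cw≡i = walk-crossing c two i≢j cw≡i cy≡j r
  ... | inj₂ cw≡j = _ , _ , cu≡i , cw≡j , e

walk-map : ∀ {n} {G : Graph n} {P Q : Fin n → Set} → (∀ {z} → P z → Q z) →
           ∀ {u v ℓ} → Walk G P u v ℓ → Walk G Q u v ℓ
walk-map f (here p)     = here (f p)
walk-map f (step p e r) = step (f p) e (walk-map f r)

walk-neighbour : ∀ {n} {G : Graph n} {P u v ℓ} → Walk G P u v ℓ → u ≢ v → ∃ (Adj G u)
walk-neighbour (here _)     u≢u = contradiction refl u≢u
walk-neighbour (step _ e _) _   = _ , e

∃-least : ∀ {P : ℕ → Set} → (∀ m → Dec (P m)) → ∀ n → P n →
          ∃ λ m → P m × (∀ k → P k → m ≤ k)
∃-least P? n pn with P? 0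
... | yes p0 = 0 , p0 , λ _ _ → z≤n
∃-least P? zero    p0 | no ¬p0 = contradiction p0 ¬p0
∃-least P? (suc n) pn | no ¬p0 with ∃-least (P? ∘ suc) n pn
... | m , pm , least = suc m , pm , λ where
  zero    p0 → contradiction p0 ¬p0
  (suc k) pk → s≤s (least k pk)

DecidableAdjacency : ∀ {n} → Graph n → Set
DecidableAdjacency {n} G = (u v : Fin n) → Dec (Adj G u v)

module Distance {n : ℕ} (G : Graph n) (adj? : DecidableAdjacency G) (connected : Connected G) where

  walk? : ∀ ℓ u v → Dec (Walk G Everywhere u v ℓ)
  walk? zero    u v = map′ (λ { refl → here tt }) (λ { (here _) → refl }) (u ≟ v)
  walk? (suc ℓ) u v = map′ (λ (w , e , r) → step tt e r) (λ { (step _ e r) → _ , e , r })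
                           (any? λ w → adj? u w ×-dec walk? ℓ w v)

  shortest : ∀ u v → ∃ (Dist G u v)
  shortest u v = ∃-least (λ ℓ → walk? ℓ u v) _ (proj₂ (connected u v))

  -- Opaque, so that unification never unfolds the search for a shortest walk.
  opaque
    dist : Fin n → Fin n → ℕ
    dist u v = proj₁ (shortest u v)

    dist-isDist : ∀ u v → Dist G u v (dist u v)
    dist-isDist u v = proj₂ (shortest u v)

  dist-walk : ∀ u v → Walk G Everywhere u v (dist u v)
  dist-walk u v = proj₁ (dist-isDist u v)

  dist-minimal : ∀ {u v ℓ} → Walk G Everywhere u v ℓ → dist u v ≤ ℓ
  dist-minimal = proj₂ (dist-isDist _ _) _

  dist-sym : ∀ u v → dist u v ≡ dist v u
  dist-sym u v = ≤-antisym (dist-minimal (walk-reverse (dist-walk v u)))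
                           (dist-minimal (walk-reverse (dist-walk u v)))

  dist-triangle : ∀ u v w → dist u w ≤ dist u v + dist v w
  dist-triangle u v w = dist-minimal (dist-walk u v ++ʷ dist-walk v w)

  dist-refl : ∀ {u} → dist u u ≡ 0
  dist-refl {u} = n≤0⇒n≡0 (dist-minimal {u} (here tt))

  dist≡0⇒≡ : ∀ {u v} → dist u v ≡ 0 → u ≡ v
  dist≡0⇒≡ {u} {v} eq with subst (Walk G Everywhere u v) eq (dist-walk u v)
  ... | here _ = refl

  dist-adjacentˡ : ∀ {w u y} → Adj G w u → dist w y ≤ suc (dist u y)
  dist-adjacentˡ e = dist-minimal (step tt e (dist-walk _ _))

  dist-adjacentʳ : ∀ {w u y} → Adj G w u → dist y u ≤ suc (dist y w)
  dist-adjacentʳ {w} {u} {y} e =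
    subst₂ (λ a b → a ≤ suc b) (dist-sym u y) (dist-sym w y) (dist-adjacentˡ (Graph.sym G e))

  geodesic-step : ∀ {w y L} → dist w y ≡ suc L → ∃ λ u → Adj G w u × dist u y ≡ L
  geodesic-step {w} {y} {L} eq with subst (Walk G Everywhere w y) eq (dist-walk w y)
  ... | step {w = u} _ e r = u , e , ≤-antisym (dist-minimal r)
                                      (s≤s⁻¹ (subst (_≤ suc (dist u y)) eq (dist-adjacentˡ e)))

  geodesic-walk : ∀ {y} (P : Fin n → Set) →
                  (∀ {w u} → Adj G w u → suc (dist u y) ≡ dist w y → P w → P u) →
                  ∀ {w} → P w → Walk G P w y (dist w y)
  geodesic-walk {y} P preserved pw = go _ refl pw
    where
    go : ∀ L {w} → dist w y ≡ L → P w → Walk G P w y L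
    go zero {w} eq pw with dist≡0⇒≡ {w} {y} eq
    ... | refl = here pw
    go (suc L) eq pw with geodesic-step eq
    ... | u , e , du = step pw e (go L du (preserved e (trans (cong suc du) (≡.sym eq)) pw))

-- Complete minors

module _ {n t : ℕ} (G : Graph n) (c : Fin t → Fin n)
         (clique : ∀ i j → i ≢ j → Adj G (c i) (c j)) where

  clique-injective : ∀ {i j} → c i ≡ c j → i ≡ j
  clique-injective {i} {j} ci≡cj with i ≟ j
  ... | yes i≡j = i≡j
  ... | no i≢j  =
    contradiction (subst (Adj G (c i)) (≡.sym ci≡cj) (clique i j i≢j)) (Graph.irrefl G)

  clique-branch : Fin n → Maybe (Fin t)
  clique-branch v with any? (λ i → c i ≟ v)
  ... | yes (i , _) = just i
  ... | no _        = nothing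

  clique-branch-sound : ∀ {i v} → InBranch clique-branch i v → c i ≡ v
  clique-branch-sound {i} {v} inB with any? (λ i → c i ≟ v)
  clique-branch-sound refl | yes (_ , ci≡v) = ci≡v

  clique-branch-complete : ∀ i → InBranch clique-branch i (c i)
  clique-branch-complete i with any? (λ j → c j ≟ c i)
  ... | yes (j , cj≡ci) = cong just (clique-injective cj≡ci)
  ... | no none         = contradiction (i , refl) none

  clique⇒complete-minor : HasCompleteMinor G t
  clique⇒complete-minor =
    clique-branch , (λ i → c i , clique-branch-complete i) , branch-connected , branch-adjacent
    where
    branch-connected : ∀ i u v → InBranch clique-branch i u → InBranch clique-branch i v →
                       ∃ λ ℓ → Walk G (InBranch clique-branch i) u v ℓ
    branch-connected i u v u∈i v∈i with clique-branch-sound u∈i | clique-branch-sound v∈i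
    ... | refl | refl = 0 , here u∈i
    branch-adjacent : ∀ i j → i ≢ j → ∃₂ λ u v →
                      InBranch clique-branch i u × InBranch clique-branch j v × Adj G u v
    branch-adjacent i j i≢j =
      c i , c j , clique-branch-complete i , clique-branch-complete j , clique i j i≢j

edge⇒complete-minor : ∀ {n} (G : Graph n) {u v} → Adj G u v → HasCompleteMinor G 2
edge⇒complete-minor {n} G {u} {v} e = clique⇒complete-minor G ends adjacent
  where
  ends : Fin 2 → Fin n
  ends zero    = u
  ends (suc _) = v
  adjacent : ∀ i j → i ≢ j → Adj G (ends i) (ends j)
  adjacent zero       zero       0≢0 = contradiction refl 0≢0
  adjacent zero       (suc zero) _   = e
  adjacent (suc zero) zero       _   = Graph.sym G e
  adjacent (suc zero) (suc zero) 1≢1 = contradiction refl 1≢1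

small-complete-minor : ∀ {n t} (G : Graph n) → Connected G → t ≤ 2 → t ≤ n →
                       HasCompleteMinor G t
small-complete-minor G _ z≤n _ = clique⇒complete-minor G (λ ()) (λ ())
small-complete-minor {suc n} G _ (s≤s z≤n) _ =
  clique⇒complete-minor G (λ _ → zero) λ { zero zero 0≢0 → contradiction refl 0≢0 }
small-complete-minor G connected (s≤s (s≤s z≤n)) (s≤s (s≤s _)) =
  edge⇒complete-minor G (proj₂ (walk-neighbour (proj₂ (connected zero (suc zero))) λ ()))

module BallMinor {n t : ℕ} (G : Graph n) (adj? : DecidableAdjacency G) (connected : Connected G)
                 (x : Fin (3 + t) → Fin n) (ρ : Fin (3 + t) → ℕ) (M : ℕ) (ρ≤M : ∀ a → ρ a ≤ M)
                 where

  open Distance G adj? connected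

  N : ℕ
  N = 3 + t

  InBall : Fin N → Fin n → Set
  InBall a w = dist w (x a) ≤ ρ a

  OnlyIn : Fin N → Fin N → Fin n → Set
  OnlyIn i j v = ∀ l → InBall l v ⇔ (l ≡ i ⊎ l ≡ j)

  OnlyIn-swap : ∀ {i j v} → OnlyIn i j v → OnlyIn j i v
  OnlyIn-swap only l =
    mk⇔ (Sum.swap ∘ Equivalence.to (only l)) (Equivalence.from (only l) ∘ Sum.swap)

  in-ballˡ : ∀ {i j v} → OnlyIn i j v → InBall i v
  in-ballˡ only = Equivalence.from (only _) (inj₁ refl)

  in-ballʳ : ∀ {i j v} → OnlyIn i j v → InBall j v
  in-ballʳ only = Equivalence.from (only _) (inj₂ refl)

  -- weight a w = d(w, x a) − ρ a + M, shifted by M to stay in ℕ. Cells are the additively weighted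
  -- Voronoi cells for this weight, ties broken by the index: rank orders (weight, index)
  -- lexicographically.
  weight : Fin N → Fin n → ℕ
  weight a w = dist w (x a) + (M ∸ ρ a)

  InBall⇔weight≤M : ∀ {a w} → InBall a w ⇔ weight a w ≤ M
  InBall⇔weight≤M {a} {w} = mk⇔
    (λ inB → subst (weight a w ≤_) (m+[n∸m]≡n (ρ≤M a)) (+-monoˡ-≤ (M ∸ ρ a) inB))
    (λ w≤M → +-cancelʳ-≤ (M ∸ ρ a) _ _
               (subst (weight a w ≤_) (≡.sym (m+[n∸m]≡n (ρ≤M a))) w≤M))

  weight-adjacent : ∀ {a w u} → Adj G w u → weight a w ≤ suc (weight a u)
  weight-adjacent {a} e = +-monoˡ-≤ (M ∸ ρ a) (dist-adjacentˡ e)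

  weight-triangle : ∀ a v u → weight a v ≤ dist v u + weight a u
  weight-triangle a v u = begin
    dist v (x a) + (M ∸ ρ a)                ≤⟨ +-monoˡ-≤ (M ∸ ρ a) (dist-triangle v u (x a)) ⟩
    (dist v u + dist u (x a)) + (M ∸ ρ a)   ≡⟨ +-assoc (dist v u) _ _ ⟩
    dist v u + weight a u                   ∎
    where open ≤-Reasoning

  rank : Fin N → Fin n → ℕ
  rank a w = toℕ a + weight a w * N

  rank-mod : ∀ a w → rank a w % N ≡ toℕ a
  rank-mod a w = trans ([m+kn]%n≡m%n (toℕ a) (weight a w) N) (m<n⇒m%n≡m (toℕ<n a))

  rank-injective : ∀ {i l w} → rank i w ≡ rank l w → i ≡ l
  rank-injective {i} {l} {w} eq =
    toℕ-injective (trans (≡.sym (rank-mod i w)) (trans (cong (_% N) eq) (rank-mod l w)))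

  rank-mono : ∀ {j l w} → weight j w < weight l w → rank j w < rank l w
  rank-mono {j} {l} {w} lt = begin-strict
    toℕ j + weight j w * N   <⟨ +-monoˡ-< (weight j w * N) (toℕ<n j) ⟩
    suc (weight j w) * N     ≤⟨ *-monoˡ-≤ N lt ⟩
    weight l w * N           ≤⟨ m≤n+m _ (toℕ l) ⟩
    rank l w                 ∎
    where open ≤-Reasoning

  rank-adjacent : ∀ {a w u} → Adj G w u → rank a w ≤ N + rank a u
  rank-adjacent {a} {w} {u} e = begin
    toℕ a + weight a w * N          ≤⟨ +-monoʳ-≤ (toℕ a) (*-monoˡ-≤ N (weight-adjacent e)) ⟩
    toℕ a + (N + weight a u * N)    ≡⟨ x∙yz≈y∙xz (toℕ a) N _ ⟩
    N + rank a u                    ∎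
    where open ≤-Reasoning

  rank-geodesic : ∀ {a w u} → suc (dist u (x a)) ≡ dist w (x a) → N + rank a u ≡ rank a w
  rank-geodesic {a} {w} {u} geo = begin
    N + (toℕ a + weight a u * N)    ≡⟨ x∙yz≈y∙xz N (toℕ a) _ ⟩
    toℕ a + suc (weight a u) * N    ≡⟨ cong (λ d → toℕ a + (d + (M ∸ ρ a)) * N) geo ⟩
    rank a w                        ∎
    where open ≡.≡-Reasoning

  opaque
    cell : Fin n → Fin N
    cell w = argmin (λ a → rank a w) zero (allFin N)

    cell-minimal : ∀ w l → rank (cell w) w ≤ rank l w
    cell-minimal w l =
      All.lookup (f[argmin]≤f[xs] {f = λ a → rank a w} zero (allFin N)) (∈-allFin l)

  cell-minimal-weight : ∀ w l → weight (cell w) w ≤ weight l w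
  cell-minimal-weight w l = ≮⇒≥ λ lt → <⇒≱ (rank-mono lt) (cell-minimal w l)

  cell-strict : ∀ {w l} → l ≢ cell w → rank (cell w) w < rank l w
  cell-strict {w} {l} l≢c = ≤∧≢⇒< (cell-minimal w l) (λ eq → l≢c (≡.sym (rank-injective eq)))

  cell-unique : ∀ {w i} → (∀ l → l ≢ i → rank i w < rank l w) → cell w ≡ i
  cell-unique {w} {i} below with cell w ≟ i
  ... | yes c≡i = c≡i
  ... | no c≢i  = contradiction (cell-minimal w i) (<⇒≱ (below (cell w) c≢i))

  cell-geodesic : ∀ {i w u} → Adj G w u → suc (dist u (x i)) ≡ dist w (x i) →
                  cell w ≡ i → cell u ≡ i
  cell-geodesic {i} {w} {u} e geo cw≡i = cell-unique λ l l≢i → +-cancelˡ-< N _ _ (begin-strict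
    N + rank i u      ≡⟨ rank-geodesic geo ⟩
    rank i w          ≡⟨ cong (λ c → rank c w) (≡.sym cw≡i) ⟩
    rank (cell w) w   <⟨ cell-strict (λ l≡c → l≢i (trans l≡c cw≡i)) ⟩
    rank l w          ≤⟨ rank-adjacent e ⟩
    N + rank l u      ∎)
    where open ≤-Reasoning

  cell-walk : ∀ {i w} → cell w ≡ i → Walk G (λ z → cell z ≡ i) w (x i) (dist w (x i))
  cell-walk = geodesic-walk _ (λ e geo → cell-geodesic e geo)

  cell-near : ∀ {i j v a u} → OnlyIn i j v → dist v u + weight a u ≤ M →
              cell u ≡ i ⊎ cell u ≡ j
  cell-near {i} {j} {v} {a} {u} only near with cell u ≟ i | cell u ≟ j
  ... | yes c≡i | _       = inj₁ c≡i
  ... | no _    | yes c≡j = inj₂ c≡j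
  ... | no c≢i  | no c≢j  =
    contradiction (Equivalence.to (only (cell u)) (Equivalence.from InBall⇔weight≤M in-cell-ball))
                  [ c≢i , c≢j ]
    where
    in-cell-ball : weight (cell u) v ≤ M
    in-cell-ball = begin
      weight (cell u) v            ≤⟨ weight-triangle (cell u) v u ⟩
      dist v u + weight (cell u) u ≤⟨ +-monoʳ-≤ (dist v u) (cell-minimal-weight u a) ⟩
      dist v u + weight a u        ≤⟨ near ⟩
      M                            ∎
      where open ≤-Reasoning

  near-centre : ∀ {a v} → InBall a v → dist v (x a) + weight a (x a) ≤ M
  near-centre {a} {v} inB = subst (λ d → dist v (x a) + (d + (M ∸ ρ a)) ≤ M) (≡.sym dist-refl)
                                  (Equivalence.to InBall⇔weight≤M inB)

  near-self : ∀ {a v} → InBall a v → dist v v + weight a v ≤ M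
  near-self {a} {v} inB =
    subst (λ d → d + weight a v ≤ M) (≡.sym dist-refl) (Equivalence.to InBall⇔weight≤M inB)

  near-geodesic : ∀ {j v w u} → Adj G w u → suc (dist u (x j)) ≡ dist w (x j) →
                  dist v w + weight j w ≤ M → dist v u + weight j u ≤ M
  near-geodesic {j} {v} {w} {u} e geo near = begin
    dist v u + weight j u           ≤⟨ +-monoˡ-≤ (weight j u) (dist-adjacentʳ e) ⟩
    suc (dist v w) + weight j u     ≡⟨ +-suc (dist v w) (weight j u) ⟨
    dist v w + suc (weight j u)     ≡⟨ cong (λ d → dist v w + (d + (M ∸ ρ j))) geo ⟩
    dist v w + weight j w           ≤⟨ near ⟩
    M                               ∎
    where open ≤-Reasoning

  two-others : ∀ (i : Fin N) → ∃₂ λ j l → i ≢ j × i ≢ l × j ≢ l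
  two-others zero          = suc zero , suc (suc zero) , (λ ()) , (λ ()) , (λ ())
  two-others (suc zero)    = zero , suc (suc zero) , (λ ()) , (λ ()) , (λ ())
  two-others (suc (suc _)) = zero , suc zero , (λ ()) , (λ ()) , (λ ())

  Separated : Set
  Separated = ∀ i j → i ≢ j → ∃ (OnlyIn i j)

  module _ (separated : Separated) where

    -- This needs three balls: the witness for {i, j} puts x i into cell i or j, that for {i, l}
    -- into cell i or l.
    centre-cell : ∀ i → cell (x i) ≡ i
    centre-cell i with two-others i
    ... | j , l , i≢j , i≢l , j≢l with separated i j i≢j | separated i l i≢l
    ... | v , only | v′ , only′ with cell-near only (near-centre (in-ballˡ only))
                                   | cell-near only′ (near-centre (in-ballˡ only′))
    ... | inj₁ c≡i | _        = c≡i
    ... | inj₂ _   | inj₁ c≡i = c≡i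
    ... | inj₂ c≡j | inj₂ c≡l = contradiction (trans (≡.sym c≡j) c≡l) j≢l

    -- Along a geodesic from v to x j the quantity d(v, z) + weight j z does not increase, so every
    -- vertex on it lies in cell i or cell j, and the geodesic crosses from one to the other.
    cells-adjacent-from : ∀ {i j v} → i ≢ j → OnlyIn i j v → cell v ≡ i →
                          ∃₂ λ p q → cell p ≡ i × cell q ≡ j × Adj G p q
    cells-adjacent-from {i} {j} {v} i≢j only cv≡i =
      walk-crossing cell (cell-near only) i≢j cv≡i (centre-cell j)
        (geodesic-walk (λ z → dist v z + weight j z ≤ M) near-geodesic (near-self (in-ballʳ only)))

    cells-adjacent : ∀ {i j} → i ≢ j → ∃₂ λ p q → cell p ≡ i × cell q ≡ j × Adj G p q
    cells-adjacent {i} {j} i≢j with separated i j i≢j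
    ... | v , only with cell-near only (near-self (in-ballˡ only))
    ... | inj₁ cv≡i = cells-adjacent-from i≢j only cv≡i
    ... | inj₂ cv≡j with cells-adjacent-from (i≢j ∘ ≡.sym) (OnlyIn-swap only) cv≡j
    ...   | p , q , cp≡j , cq≡i , e = q , p , cq≡i , cp≡j , Graph.sym G e

    complete-minor : HasCompleteMinor G N
    complete-minor =
      just ∘ cell , (λ i → x i , cong just (centre-cell i)) , branch-connected , branch-adjacent
      where
      branch-connected : ∀ i u v → just (cell u) ≡ just i → just (cell v) ≡ just i →
                         ∃ λ ℓ → Walk G (InBranch (just ∘ cell) i) u v ℓ
      branch-connected i u v cu cv = _ , walk-map (cong just)
        (cell-walk (just-injective cu) ++ʷ walk-reverse (cell-walk (just-injective cv)))
      branch-adjacent : ∀ i j → i ≢ j → ∃₂ λ u v →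
                        just (cell u) ≡ just i × just (cell v) ≡ just j × Adj G u v
      branch-adjacent i j i≢j with cells-adjacent i≢j
      ... | p , q , cp≡i , cq≡j , e = p , q , cong just cp≡i , cong just cq≡j , e

-- Set families and the Sauer–Shelah lemma

Family : ℕ → Set
Family m = Subset m → Bool

_∪_ _∩_ : ∀ {m} → Family m → Family m → Family m
(A ∪ B) g = A g ∨ B g
(A ∩ B) g = A g ∧ B g

size : ∀ {m} → Family m → ℕ
size {zero}  A = if A [] then 1 else 0
size {suc m} A = size (A ∘ (false ∷_)) + size (A ∘ (true ∷_))

size-∅ : ∀ {m} (A : Family m) → (∀ g → ¬ T (A g)) → size A ≡ 0
size-∅ {zero}  A empty with A [] | empty []
... | false | _   = refl
... | true  | ¬tt = contradiction tt ¬tt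
size-∅ {suc m} A empty =
  cong₂ _+_ (size-∅ _ (empty ∘ (false ∷_))) (size-∅ _ (empty ∘ (true ∷_)))

size-∪-∩ : ∀ {m} (A B : Family m) → size (A ∪ B) + size (A ∩ B) ≡ size A + size B
size-∪-∩ {zero} A B with A [] | B []
... | true  | true  = refl
... | true  | false = refl
... | false | true  = refl
... | false | false = refl
size-∪-∩ {suc m} A B = begin
  (size (A₀ ∪ B₀) + size (A₁ ∪ B₁)) + (size (A₀ ∩ B₀) + size (A₁ ∩ B₁))
    ≡⟨ interchange (size (A₀ ∪ B₀)) (size (A₁ ∪ B₁)) (size (A₀ ∩ B₀)) (size (A₁ ∩ B₁)) ⟩
  (size (A₀ ∪ B₀) + size (A₀ ∩ B₀)) + (size (A₁ ∪ B₁) + size (A₁ ∩ B₁))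
    ≡⟨ cong₂ _+_ (size-∪-∩ A₀ B₀) (size-∪-∩ A₁ B₁) ⟩
  (size A₀ + size B₀) + (size A₁ + size B₁)
    ≡⟨ interchange (size A₀) (size B₀) (size A₁) (size B₁) ⟩
  (size A₀ + size A₁) + (size B₀ + size B₁) ∎
  where
  open ≡.≡-Reasoning
  A₀ A₁ B₀ B₁ : Family m
  A₀ = A ∘ (false ∷_)
  A₁ = A ∘ (true ∷_)
  B₀ = B ∘ (false ∷_)
  B₁ = B ∘ (true ∷_)

size-∪-disjoint : ∀ {m} (A B : Family m) → (∀ g → ¬ T ((A ∩ B) g)) →
                  size (A ∪ B) ≡ size A + size B
size-∪-disjoint A B disjoint = begin
  size (A ∪ B)                    ≡⟨ +-identityʳ _ ⟨
  size (A ∪ B) + 0                ≡⟨ cong (size (A ∪ B) +_) (size-∅ (A ∩ B) disjoint) ⟨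
  size (A ∪ B) + size (A ∩ B)     ≡⟨ size-∪-∩ A B ⟩
  size A + size B                 ∎
  where open ≡.≡-Reasoning

_≟ˢ_ : ∀ {m} → DecidableEquality (Subset m)
_≟ˢ_ = ≡-dec Bool._≟_

does⇔ : ∀ {A : Set} (a? : Dec A) → T (does a?) ⇔ A
does⇔ (yes a) = mk⇔ (λ _ → a) (λ _ → tt)
does⇔ (no ¬a) = mk⇔ (λ ()) ¬a

singleton : ∀ {m} → Subset m → Family m
singleton h g = does (h ≟ˢ g)

size-singleton : ∀ {m} (h : Subset m) → size (singleton h) ≡ 1
size-singleton []          = refl
size-singleton (false ∷ h) =
  cong₂ _+_ (size-singleton h) (size-∅ (singleton (false ∷ h) ∘ (true ∷_)) λ _ ())
size-singleton (true ∷ h)  =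
  cong₂ _+_ (size-∅ (singleton (true ∷ h) ∘ (false ∷_)) λ _ ()) (size-singleton h)

image : ∀ {n m} → (Fin n → Subset m) → Family m
image e g = does (any? λ w → e w ≟ˢ g)

image-size : ∀ {n m} (e : Fin n → Subset m) → Injective _≡_ _≡_ e → n ≤ size (image e)
image-size {zero}  e _         = z≤n
image-size {suc n} e injective = begin
  suc n
    ≤⟨ s≤s (image-size (e ∘ suc) (suc-injective ∘ injective)) ⟩
  suc (size (image (e ∘ suc)))
    ≡⟨ cong (_+ size (image (e ∘ suc))) (size-singleton (e zero)) ⟨
  size (singleton (e zero)) + size (image (e ∘ suc))
    ≡⟨ size-∪-disjoint _ _ disjoint ⟨
  size (image e) ∎
  where
  open ≤-Reasoning
  disjoint : ∀ g → ¬ T ((singleton (e zero) ∩ image (e ∘ suc)) g)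
  disjoint g both with Equivalence.to T-∧ both
  ... | first , rest with Equivalence.to (does⇔ (e zero ≟ˢ g)) first
                        | Equivalence.to (does⇔ (any? λ w → e (suc w) ≟ˢ g)) rest
  ... | e₀≡g | w , e[1+w]≡g =
    contradiction (injective {zero} {suc w} (trans e₀≡g (≡.sym e[1+w]≡g))) λ ()

Shatters : ∀ {m t} → Family m → (Fin t → Fin m) → Set
Shatters {t = t} A s =
  ∀ (p : Fin t → Bool) → ∃ λ g → T (A g) × (∀ a → lookup g (s a) ≡ p a)

-- Φ m t = Σ_{i<t} (m choose i)
Φ : ℕ → ℕ → ℕ
Φ _       zero    = 0
Φ zero    (suc t) = 1
Φ (suc m) (suc t) = Φ m (suc t) + Φ m t

sauer-shelah : ∀ m t (A : Family m) → (∀ (s : Fin t → Fin m) → ¬ Shatters A s) →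
               size A ≤ Φ m t
sauer-shelah m zero A shatters-nothing = ≤-reflexive (size-∅ A λ g g∈A →
  shatters-nothing (λ ()) (λ _ → g , g∈A , λ ()))
sauer-shelah zero (suc t) A _ with A []
... | true  = ≤-refl
... | false = z≤n
sauer-shelah (suc m) (suc t) A shatters-nothing = begin
  size A₀ + size A₁               ≡⟨ size-∪-∩ A₀ A₁ ⟨
  size (A₀ ∪ A₁) + size (A₀ ∩ A₁) ≤⟨ +-mono-≤ (sauer-shelah m (suc t) _ union)
                                              (sauer-shelah m t _ intersection) ⟩
  Φ m (suc t) + Φ m t             ∎
  where
  open ≤-Reasoning
  A₀ A₁ : Family m
  A₀ = A ∘ (false ∷_)
  A₁ = A ∘ (true ∷_)
  union : ∀ (s : Fin (suc t) → Fin m) → ¬ Shatters (A₀ ∪ A₁) s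
  union s shatters = shatters-nothing (suc ∘ s) λ p → extend p (shatters p)
    where
    extend : ∀ p → ∃ (λ g → T ((A₀ ∪ A₁) g) × (∀ a → lookup g (s a) ≡ p a)) →
             ∃ λ g → T (A g) × (∀ a → lookup g (suc (s a)) ≡ p a)
    extend p (g , g∈A₀∪A₁ , agrees) with Equivalence.to T-∨ g∈A₀∪A₁
    ... | inj₁ g∈A₀ = false ∷ g , g∈A₀ , agrees
    ... | inj₂ g∈A₁ = true ∷ g , g∈A₁ , agrees
  intersection : ∀ (s : Fin t → Fin m) → ¬ Shatters (A₀ ∩ A₁) s
  intersection s shatters = shatters-nothing s′ λ p → extend p (shatters (p ∘ suc))
    where
    s′ : Fin (suc t) → Fin (suc m)
    s′ zero    = zero
    s′ (suc a) = suc (s a)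
    extend : ∀ p → ∃ (λ g → T ((A₀ ∩ A₁) g) × (∀ a → lookup g (s a) ≡ p (suc a))) →
             ∃ λ g → T (A g) × (∀ a → lookup g (s′ a) ≡ p a)
    extend p (g , g∈A₀∩A₁ , agrees) =
      p zero ∷ g , both (p zero) (Equivalence.to T-∧ g∈A₀∩A₁) , λ where
        zero    → refl
        (suc a) → agrees a
      where
      both : ∀ b → T (A₀ g) × T (A₁ g) → T (A (b ∷ g))
      both false = proj₁
      both true  = proj₂

Φ-bound : ∀ m t → Φ m (suc t) ≤ suc m ^ t
Φ-bound zero    t       = ≤-reflexive (≡.sym (^-zeroˡ t))
Φ-bound (suc m) zero    = ≤-reflexive (Φ-one (suc m))
  where
  Φ-one : ∀ m → Φ m 1 ≡ 1
  Φ-one zero    = refl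
  Φ-one (suc m) = cong (_+ 0) (Φ-one m)
Φ-bound (suc m) (suc t) = begin
  Φ m (suc (suc t)) + Φ m (suc t)
    ≤⟨ +-mono-≤ (Φ-bound m (suc t)) (Φ-bound m t) ⟩
  suc m * suc m ^ t + suc m ^ t
    ≤⟨ +-mono-≤ (*-monoʳ-≤ (suc m) (^-monoˡ-≤ t (n≤1+n _))) (^-monoˡ-≤ t (n≤1+n _)) ⟩
  suc m * suc (suc m) ^ t + suc (suc m) ^ t
    ≡⟨ +-comm (suc m * suc (suc m) ^ t) (suc (suc m) ^ t) ⟩
  suc (suc m) ^ suc t ∎
  where open ≤-Reasoning

-- Encoding vertices by balls around a resolving set

does-≡⇒⇔ : ∀ {A B : Set} (a? : Dec A) (b? : Dec B) → does a? ≡ does b? → A ⇔ B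
does-≡⇒⇔ (yes a) (yes b) _ = mk⇔ (λ _ → b) (λ _ → a)
does-≡⇒⇔ (no ¬a) (no ¬b) _ = mk⇔ (λ a → contradiction a ¬a) (λ b → contradiction b ¬b)

≤-by-thresholds : ∀ {a b d} → b ≤ d → (∀ (r : Fin d) → a ≤ toℕ r → b ≤ toℕ r) → b ≤ a
≤-by-thresholds {a} {b} {d} b≤d below with a <? d
... | yes a<d =
  subst (b ≤_) (toℕ-fromℕ< a<d) (below (fromℕ< a<d) (≤-reflexive (≡.sym (toℕ-fromℕ< a<d))))
... | no a≮d  = ≤-trans b≤d (≮⇒≥ a≮d)

≡-by-thresholds : ∀ {a b d} → a ≤ d → b ≤ d → (∀ (r : Fin d) → a ≤ toℕ r ⇔ b ≤ toℕ r) →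
                  a ≡ b
≡-by-thresholds a≤d b≤d same = ≤-antisym (≤-by-thresholds a≤d (Equivalence.from ∘ same))
                                         (≤-by-thresholds b≤d (Equivalence.to ∘ same))

element : ∀ {n} (R : Subset n) → Fin ∣ R ∣ → Fin n
element (true ∷ R)  zero    = zero
element (true ∷ R)  (suc a) = suc (element R a)
element (false ∷ R) a       = suc (element R a)

element-surjective : ∀ {n} (R : Subset n) {x} → x ∈ R → ∃ λ a → element R a ≡ x
element-surjective (true ∷ R)  here        = zero , refl
element-surjective (true ∷ R)  (there x∈R) =
  Product.map suc (cong suc) (element-surjective R x∈R)
element-surjective (false ∷ R) (there x∈R) = Product.map₂ (cong suc) (element-surjective R x∈R)

module BallEncoding {n : ℕ} (G : Graph n) (adj? : DecidableAdjacency G) (connected : Connected G)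
                    {d : ℕ} (diameter : ∀ u v ℓ → Dist G u v ℓ → ℓ ≤ d)
                    {R : Subset n} (resolving : Resolving G R) where

  open Distance G adj? connected

  k : ℕ
  k = ∣ R ∣

  InBall : Fin d × Fin k → Fin n → Set
  InBall b w = dist w (element R (proj₂ b)) ≤ toℕ (proj₁ b)

  inBall? : ∀ b w → Dec (InBall b w)
  inBall? b w = dist w (element R (proj₂ b)) ≤? toℕ (proj₁ b)

  code : Fin n → Subset (d * k)
  code w = tabulate λ c → does (inBall? (remQuot k c) w)

  lookup-code : ∀ w r a → lookup (code w) (combine r a) ≡ does (inBall? (r , a) w)
  lookup-code w r a =
    trans (lookup∘tabulate _ (combine r a)) (cong (λ b → does (inBall? b w)) (remQuot-combine r a))

  code-injective : Injective _≡_ _≡_ code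
  code-injective {w} {w′} code-w≡code-w′ with w ≟ w′
  ... | yes w≡w′ = w≡w′
  ... | no w≢w′ with resolving w w′ w≢w′
  ... | y , y∈R , distinguishes with element-surjective R y∈R
  ... | a , refl =
    contradiction same-distance (distinguishes _ _ (dist-isDist _ w) (dist-isDist _ w′))
    where
    L : Fin n
    L = element R a
    same-ball : ∀ r → InBall (r , a) w ⇔ InBall (r , a) w′
    same-ball r = does-≡⇒⇔ (inBall? (r , a) w) (inBall? (r , a) w′) (begin
      does (inBall? (r , a) w)       ≡⟨ lookup-code w r a ⟨
      lookup (code w) (combine r a)  ≡⟨ cong (λ g → lookup g (combine r a)) code-w≡code-w′ ⟩
      lookup (code w′) (combine r a) ≡⟨ lookup-code w′ r a ⟩
      does (inBall? (r , a) w′)      ∎)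
      where open ≡.≡-Reasoning
    same-distance : dist L w ≡ dist L w′
    same-distance = begin
      dist L w   ≡⟨ dist-sym L w ⟩
      dist w L   ≡⟨ ≡-by-thresholds (diameter _ _ _ (dist-isDist w L))
                                    (diameter _ _ _ (dist-isDist w′ L)) same-ball ⟩
      dist w′ L  ≡⟨ dist-sym w′ L ⟩
      dist L w′  ∎
      where open ≡.≡-Reasoning

  shattered⇒complete-minor : ∀ {t} (s : Fin (3 + t) → Fin (d * k)) → Shatters (image code) s →
                             HasCompleteMinor G (3 + t)
  shattered⇒complete-minor {t} s shatters =
    BallMinor.complete-minor G adj? connected centre radius d radius≤d separated
    where
    centre : Fin (3 + t) → Fin n
    centre = element R ∘ proj₂ ∘ remQuot {d} k ∘ s
    radius : Fin (3 + t) → ℕ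
    radius = toℕ ∘ proj₁ ∘ remQuot {d} k ∘ s
    radius≤d : ∀ i → radius i ≤ d
    radius≤d i = <⇒≤ (toℕ<n (proj₁ (remQuot {d} k (s i))))
    separated : BallMinor.Separated G adj? connected centre radius d radius≤d
    separated i j _ with shatters (λ l → does (l ≟ i ⊎-dec l ≟ j))
    ... | g , g∈image , agrees with Equivalence.to (does⇔ (any? λ w → code w ≟ˢ g)) g∈image
    ... | w , refl = w , λ l → does-≡⇒⇔ (inBall? (remQuot k (s l)) w) (l ≟ i ⊎-dec l ≟ j)
                                  (trans (≡.sym (lookup∘tabulate _ (s l))) (agrees l))

  order-bound : ∀ {t} → MinorFree G (3 + t) → n ≤ (d * k + 1) ^ (2 + t)
  order-bound {t} minor-free = begin
    n                        ≤⟨ image-size code code-injective ⟩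
    size (image code)        ≤⟨ sauer-shelah (d * k) (3 + t) (image code)
                                              (λ s → minor-free ∘ shattered⇒complete-minor s) ⟩
    Φ (d * k) (3 + t)        ≤⟨ Φ-bound (d * k) (2 + t) ⟩
    suc (d * k) ^ (2 + t)    ≡⟨ cong (_^ (2 + t)) (+-comm 1 (d * k)) ⟩
    (d * k + 1) ^ (2 + t)    ∎
    where open ≤-Reasoning

¬¬-decidable-adjacency : ∀ {n} (G : Graph n) → ¬ ¬ DecidableAdjacency G
¬¬-decidable-adjacency G =
  sequence rawApplicative λ u → sequence rawApplicative λ v → ¬¬-excluded-middle
  where open RawMonad ¬¬-Monad using (rawApplicative)

-- Adjacency is not assumed decidable, but the conclusion is, so it may be proved under ¬ ¬.
minor-free-order : ∀ {n t d} (G : Graph n) → Connected G → MinorFree G (3 + t) →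
                   (∀ u v ℓ → Dist G u v ℓ → ℓ ≤ d) → (R : Subset n) → Resolving G R →
                   n ≤ (d * ∣ R ∣ + 1) ^ (2 + t)
minor-free-order {n} {t} {d} G connected minor-free diameter R resolving =
  decidable-stable (_ ≤? _) (¬¬-map order-bound (¬¬-decidable-adjacency G))
  where
  order-bound : DecidableAdjacency G → n ≤ (d * ∣ R ∣ + 1) ^ (2 + t)
  order-bound adj? = BallEncoding.order-bound G adj? connected diameter resolving minor-free

minor-free-order-small : ∀ {n t} (G : Graph n) → Connected G → MinorFree G t → t ≤ 2 → n ≤ 1
minor-free-order-small G connected minor-free t≤2 =
  s≤s⁻¹ (≤-trans (≰⇒> (minor-free ∘ small-complete-minor G connected t≤2)) t≤2)

theorem5 : (t d n k : ℕ) (G : Graph n) → Connected G → MinorFree G t →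
    HasDiameter G d → (R : Subset n) → ∣ R ∣ ≡ k → Resolving G R →
    n ≤ (d * k + 1) ^ (t ∸ 1) + 1
theorem5 (suc (suc (suc t))) d n k G connected minor-free (diameter , _) R refl resolving =
  ≤-trans (minor-free-order G connected minor-free diameter R resolving) (m≤m+n _ 1)
theorem5 0 d n k G connected minor-free _ _ _ _ =
  ≤-trans (minor-free-order-small G connected minor-free z≤n) (m≤n+m 1 1)
theorem5 1 d n k G connected minor-free _ _ _ _ =
  ≤-trans (minor-free-order-small G connected minor-free (s≤s z≤n)) (m≤n+m 1 1)
theorem5 2 d n k G connected minor-free _ _ _ _ =
  ≤-trans (minor-free-order-small G connected minor-free (s≤s (s≤s z≤n)))
          (m≤n+m 1 ((d * k + 1) ^ 1))
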